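{- Fix an integer $t \ge 5$ and a real number $Y$ with $\mathrm{e}^{(t-1)/2} < Y < \mathrm{e}^t$. Then the number of integers $n$ with $\mathrm{e}^{t-1} < n \le \mathrm{e}^t$ such that $Z(n) \le Y$ is at most $196\, Y t^2$.
   Context: For a positive integer $m$ let $T(m) = m(m+1)/2$. The pseudo-Smarandache function is defined for positive integers $n$ by $Z(n) = \min\{ m \ge 1 : n \mid T(m) \}$. Here $\mathrm{e}$ is the base of the natural logarithm.
   Formalization: The parameter Y ranges over the rationals rather than the reals. -}

module Defs where

open import Data.Nat using (ℕ; zero; suc; _+_; _*_; _∸_; _^_; _<_; NonZero)
open import Data.Nat.Divisibility using (_∣_; _∣?_)
open import Data.Integer using (+_)
open import Data.Rational using (ℚ) renaming (_/_ to _/ℚ_; _*_ to _*ℚ_; _<_ to _<ℚ_)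
open import Data.Product using (Σ; _×_)
open import Relation.Nullary using (yes; no)

T : ℕ → ℕ
T m = Data.Nat._/_ (m * suc m) 2

search : ℕ → ℕ → ℕ → ℕ
search n m zero = m
search n m (suc fuel) with n ∣? T m
... | yes _ = m
... | no  _ = search n (suc m) fuel

-- pseudo-Smarandache function Z(n) = min { m ≥ 1 : n ∣ T(m) }.
-- For n ≥ 1 the minimum is ≤ 2n-1 (n ∣ T(2n-1) = n(2n-1)), so the
-- search from 1 with fuel 2n finds it.  (Z 0 is a junk value, unused.)
Z : ℕ → ℕ
Z n = search n 1 (2 * n)

ℕ→ℚ : ℕ → ℚ
ℕ→ℚ n = (+ n) /ℚ 1

-- "q < e^k":  q < (1 + k/N)^N for some N ≥ 1  (these increase to e^k)
LtExp : ℕ → ℚ → Set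
LtExp k q = Σ ℕ λ N → Σ (NonZero N) λ _ →
  (q *ℚ ℕ→ℚ (N ^ N)) <ℚ ℕ→ℚ ((N + k) ^ N)

-- "e^k < q":  (1 - k/N)^(-N) < q for some N > k  (these decrease to e^k)
ExpLt : ℕ → ℚ → Set
ExpLt k q = Σ ℕ λ N → (k < N) ×
  (ℕ→ℚ (N ^ N) <ℚ (q *ℚ ℕ→ℚ ((N ∸ k) ^ N)))

{-# OPTIONS --safe #-}
module Submission where

-- Let y ≤ Y be the largest value of Z on the list. For m = Z n, the divisor n of m(m + 1)
-- splits as n = ab with m = au, m + 1 = bv and u, v coprime; since au ≡ -1 (mod v), n is
-- determined by u, v and ⌊a/v⌋. From y < e^t ≤ 4e^(t-1) < 4n we get uv·n = m(m + 1) < 4n(y + 1),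
-- so uv < 4(y + 1) ≤ 2^J for J = 2t + 2, using e^t ≤ 4^t. Sorting u and v into dyadic ranges
-- [2^i, 2^(i+1)) and [2^j, 2^(j+1)) with i, j < J, each of the J² boxes receives at most
-- 2^(i+j)(⌊y/2^(i+j)⌋ + 1) ≤ 5y + 4 triples (u, v, ⌊a/v⌋), so the list has length at most
-- J²(5y + 4) ≤ 196yt².

open import Defs
open import Data.Nat using (ℕ; _≤_; _∸_; _^_)
open import Data.List using (List; length)
open import Data.List.Relation.Unary.All using (All)
open import Data.List.Relation.Unary.Unique.Propositional using (Unique)
open import Data.Rational using (ℚ; 0ℚ) renaming (_<_ to _<ℚ_; _≤_ to _≤ℚ_; _*_ to _*ℚ_)
open import Data.Product using (_×_)
open import Relation.Nullary using (¬_)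

open import Data.Nat
open import Data.Nat.Properties
open import Algebra.Properties.CommutativeSemigroup *-commutativeSemigroup
  using (xy∙z≈xz∙y) renaming (interchange to *-interchange)
open import Data.Nat.DivMod
open import Data.Nat.Divisibility
open import Data.Nat.GCD using (gcd; gcd[m,n]∣m; gcd[m,n]∣n; gcd[m,n]≢0)
open import Data.Nat.Coprimality as Coprime using (Coprime; coprime-divisor; coprime-/gcd; 1-coprimeTo)
open import Data.Nat.Tactic.RingSolver using (solve-∀)
import Data.Integer as ℤ
import Data.Integer.Properties as ℤ
open import Data.Rational as ℚ using (mkℚ)
import Data.Rational.Properties as ℚ
open import Data.Fin using (Fin; zero; suc; toℕ; fromℕ<)
open import Data.Fin.Properties using (injective⇒≤; toℕ-fromℕ<)
open import Data.List using ([]; _∷_; lookup)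
open import Data.List.Extrema.Nat using (argmax; argmax-all; f[⊥]≤f[argmax]; f[xs]≤f[argmax])
open import Data.List.Membership.Propositional.Properties using (∈-lookup)
open import Data.List.Relation.Unary.All as All using (_∷_)
open import Data.List.Relation.Unary.AllPairs using (_∷_)
open import Data.Product using (_,_; proj₂; ∃-syntax)
open import Data.Sum using (inj₁; inj₂)
open import Relation.Nullary using (yes; no)
open import Relation.Nullary.Negation using (contradiction)
open import Relation.Binary.PropositionalEquality
  using (_≡_; refl; sym; trans; cong; cong₂; subst; subst₂; module ≡-Reasoning)

-- Approximations of e^s

^-distribʳ-* : ∀ m n o → (m * n) ^ o ≡ m ^ o * n ^ o
^-distribʳ-* m n zero    = refl
^-distribʳ-* m n (suc o) = begin
  m * n * (m * n) ^ o     ≡⟨ cong (m * n *_) (^-distribʳ-* m n o) ⟩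
  m * n * (m ^ o * n ^ o) ≡⟨ *-interchange m n (m ^ o) (n ^ o) ⟩
  m * m ^ o * (n * n ^ o) ∎
  where open ≡-Reasoning

bernoulli : ∀ R c k → R ^ k * (R + k * c) ≤ (R + c) ^ k * R
bernoulli R c zero    = ≤-reflexive (cong (1 *_) (+-identityʳ R))
bernoulli R c (suc k) = begin
  R ^ suc k * (R + suc k * c)                     ≤⟨ m≤m+n _ _ ⟩
  R ^ suc k * (R + suc k * c) + R ^ k * (k * c * c) ≡⟨ expand R c k (R ^ k) ⟩
  (R + c) * (R ^ k * (R + k * c))                 ≤⟨ *-monoʳ-≤ (R + c) (bernoulli R c k) ⟩
  (R + c) * ((R + c) ^ k * R)                     ≡⟨ *-assoc (R + c) _ R ⟨
  (R + c) ^ suc k * R                             ∎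
  where
  open ≤-Reasoning
  expand : ∀ R c k X → R * X * (R + (c + k * c)) + X * (k * c * c) ≡ (R + c) * (X * (R + k * c))
  expand = solve-∀

bernoulli⁻ : ∀ d c k → (d + c) ^ suc k ≤ (d + c) * d ^ k + k * c * (d + c) ^ k
bernoulli⁻ d c zero    = m≤m+n _ _
bernoulli⁻ d c (suc k) = begin
  (d + c) * (d + c) ^ suc k                             ≤⟨ *-monoʳ-≤ (d + c) (bernoulli⁻ d c k) ⟩
  (d + c) * ((d + c) * d ^ k + k * c * (d + c) ^ k)     ≡⟨ expand d c k (d ^ k) ((d + c) ^ k) ⟩
  (d + c) * d ^ suc k + c * ((d + c) * d ^ k) + k * c * (d + c) ^ suc k
    ≤⟨ +-monoˡ-≤ (k * c * (d + c) ^ suc k) (+-monoʳ-≤ ((d + c) * d ^ suc k) grow) ⟩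
  (d + c) * d ^ suc k + c * (d + c) ^ suc k + k * c * (d + c) ^ suc k
    ≡⟨ collect (d + c) (d ^ suc k) c k ((d + c) ^ suc k) ⟩
  (d + c) * d ^ suc k + suc k * c * (d + c) ^ suc k     ∎
  where
  open ≤-Reasoning
  grow : c * ((d + c) * d ^ k) ≤ c * (d + c) ^ suc k
  grow = *-monoʳ-≤ c (*-monoʳ-≤ (d + c) (^-monoˡ-≤ k (m≤m+n d c)))
  expand : ∀ d c k D E → (d + c) * ((d + c) * D + k * c * E)
                       ≡ (d + c) * (d * D) + c * ((d + c) * D) + k * c * ((d + c) * E)
  expand = solve-∀
  collect : ∀ R D c k E → R * D + c * E + k * c * E ≡ R * D + (1 + k) * c * E
  collect = solve-∀

-- e^s lies above every (1 + s/N)^N and below every (1 - s/N)^(-N): these are the bounds used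
-- by LtExp and ExpLt. All comparisons between them are cleared of denominators.

lowerApprox-mono : ∀ P Q s .{{_ : NonZero Q}} →
  (P * Q) ^ (P * Q) * (P + s) ^ P ≤ (P * Q + s) ^ (P * Q) * P ^ P
lowerApprox-mono P Q s = begin
  R ^ R * (P + s) ^ P       ≡⟨ power (P + s) R ⟨
  (R ^ Q * (P + s)) ^ P     ≤⟨ ^-monoˡ-≤ P step ⟩
  ((R + s) ^ Q * P) ^ P     ≡⟨ power P (R + s) ⟩
  (R + s) ^ R * P ^ P       ∎
  where
  open ≤-Reasoning
  R = P * Q
  power : ∀ Y X → (X ^ Q * Y) ^ P ≡ X ^ R * Y ^ P
  power Y X = trans (^-distribʳ-* (X ^ Q) Y P)
                    (cong (_* Y ^ P) (trans (^-*-assoc X Q P) (cong (X ^_) (*-comm Q P))))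
  step : R ^ Q * (P + s) ≤ (R + s) ^ Q * P
  step = *-cancelˡ-≤ Q (begin
    Q * (R ^ Q * (P + s)) ≡⟨ lhs P Q s (R ^ Q) ⟩
    R ^ Q * (R + Q * s)   ≤⟨ bernoulli R s Q ⟩
    (R + s) ^ Q * R       ≡⟨ rhs P Q ((R + s) ^ Q) ⟩
    Q * ((R + s) ^ Q * P) ∎)
    where
    lhs : ∀ P Q s X → Q * (X * (P + s)) ≡ X * (P * Q + Q * s)
    lhs = solve-∀
    rhs : ∀ P Q W → W * (P * Q) ≡ Q * (W * P)
    rhs = solve-∀

upperApprox-antimono : ∀ P Q s q d .{{_ : NonZero P}} → s + q ≡ Q → d + s ≡ P * Q →
  (P * Q) ^ (P * Q) * q ^ Q ≤ Q ^ Q * d ^ (P * Q)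
upperApprox-antimono P Q s q d s+q≡Q d+s≡R = begin
  R ^ R * q ^ Q         ≡⟨ power R q ⟨
  (R ^ P * q) ^ Q       ≤⟨ ^-monoˡ-≤ Q step ⟩
  (Q * d ^ P) ^ Q       ≡⟨ trans (^-distribʳ-* Q (d ^ P) Q) (cong (Q ^ Q *_) (^-*-assoc d P Q)) ⟩
  Q ^ Q * d ^ R         ∎
  where
  open ≤-Reasoning
  R = P * Q
  power : ∀ X Y → (X ^ P * Y) ^ Q ≡ X ^ R * Y ^ Q
  power X Y = trans (^-distribʳ-* (X ^ P) Y Q) (cong (_* Y ^ Q) (^-*-assoc X P Q))
  step : R ^ P * q ≤ Q * d ^ P
  step = *-cancelˡ-≤ P (+-cancelʳ-≤ (P * s * R ^ P) _ _ (begin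
    P * (R ^ P * q) + P * s * R ^ P ≡⟨ lhs P s q (R ^ P) ⟩
    P * (s + q) * R ^ P             ≡⟨ cong (λ x → P * x * R ^ P) s+q≡Q ⟩
    R * R ^ P                       ≡⟨ cong (_^ suc P) d+s≡R ⟨
    (d + s) ^ suc P                 ≤⟨ bernoulli⁻ d s P ⟩
    (d + s) * d ^ P + P * s * (d + s) ^ P ≡⟨ cong (λ x → x * d ^ P + P * s * x ^ P) d+s≡R ⟩
    R * d ^ P + P * s * R ^ P       ≡⟨ cong (_+ P * s * R ^ P) (*-assoc P Q (d ^ P)) ⟩
    P * (Q * d ^ P) + P * s * R ^ P ∎))
    where
    lhs : ∀ P s q X → P * (X * q) + P * s * X ≡ P * (s + q) * X
    lhs = solve-∀

-- Both approximations are compared with those at PQ, where (PQ + s)(PQ - s) ≤ (PQ)².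
lowerApprox≤upperApprox : ∀ P Q s q .{{_ : NonZero P}} .{{_ : NonZero Q}} → s + q ≡ Q →
  (P + s) ^ P * q ^ Q ≤ P ^ P * Q ^ Q
lowerApprox≤upperApprox P Q s q s+q≡Q = *-cancelˡ-≤ (X * X) {{m*n≢0 X X}} (begin
  X * X * ((P + s) ^ P * q ^ Q)            ≡⟨ *-interchange X X ((P + s) ^ P) (q ^ Q) ⟩
  X * (P + s) ^ P * (X * q ^ Q)            ≤⟨ *-mono-≤ (lowerApprox-mono P Q s) (upperApprox-antimono P Q s q d s+q≡Q d+s≡R) ⟩
  (R + s) ^ R * P ^ P * (Q ^ Q * d ^ R)    ≡⟨ regroup ((R + s) ^ R) (P ^ P) (Q ^ Q) (d ^ R) ⟩
  (R + s) ^ R * d ^ R * (P ^ P * Q ^ Q)    ≡⟨ cong (_* (P ^ P * Q ^ Q)) (^-distribʳ-* (R + s) d R) ⟨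
  ((R + s) * d) ^ R * (P ^ P * Q ^ Q)      ≤⟨ *-monoˡ-≤ (P ^ P * Q ^ Q) (^-monoˡ-≤ R centre) ⟩
  (R * R) ^ R * (P ^ P * Q ^ Q)            ≡⟨ cong (_* (P ^ P * Q ^ Q)) (^-distribʳ-* R R R) ⟩
  X * X * (P ^ P * Q ^ Q)                  ∎)
  where
  open ≤-Reasoning
  R = P * Q
  X = R ^ R
  instance
    X≢0 : NonZero X
    X≢0 = m^n≢0 R R {{m*n≢0 P Q}}
  d = R ∸ s
  d+s≡R : d + s ≡ R
  d+s≡R = m∸n+n≡m (≤-trans (m≤m+n s q) (≤-trans (≤-reflexive s+q≡Q) (m≤n*m Q P)))
  regroup : ∀ A B C D → A * B * (C * D) ≡ A * D * (B * C)
  regroup = solve-∀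
  centre : (R + s) * d ≤ R * R
  centre = begin
    (R + s) * d                 ≡⟨ cong (λ x → (x + s) * d) d+s≡R ⟨
    (d + s + s) * d             ≤⟨ m≤m+n _ (s * s) ⟩
    (d + s + s) * d + s * s     ≡⟨ square d s ⟩
    (d + s) * (d + s)           ≡⟨ cong₂ _*_ d+s≡R d+s≡R ⟩
    R * R                       ∎
    where
    square : ∀ d s → (d + s + s) * d + s * s ≡ (d + s) * (d + s)
    square = solve-∀

lowerApprox≤4^ : ∀ N t .{{_ : NonZero N}} .{{_ : NonZero t}} → (N + t) ^ N ≤ N ^ N * 2 ^ (t + t)
lowerApprox≤4^ N t = *-cancelʳ-≤ _ _ (t ^ (t + t)) {{m^n≢0 t (t + t)}} (begin
  (N + t) ^ N * t ^ (t + t)          ≤⟨ lowerApprox≤upperApprox N (t + t) t t refl ⟩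
  N ^ N * (t + t) ^ (t + t)          ≡⟨ cong (λ x → N ^ N * x ^ (t + t)) (cong (t +_) (+-identityʳ t)) ⟨
  N ^ N * (2 * t) ^ (t + t)          ≡⟨ cong (N ^ N *_) (^-distribʳ-* 2 t (t + t)) ⟩
  N ^ N * (2 ^ (t + t) * t ^ (t + t)) ≡⟨ *-assoc (N ^ N) _ _ ⟨
  N ^ N * 2 ^ (t + t) * t ^ (t + t)  ∎)
  where
  open ≤-Reasoning
  instance
    t+t≢0 : NonZero (t + t)
    t+t≢0 = >-nonZero (+-mono-< (>-nonZero⁻¹ t) (>-nonZero⁻¹ t))

lowerApprox-suc≤4* : ∀ N s .{{_ : NonZero N}} → (N + suc s) ^ N ≤ 4 * (N + s) ^ N
lowerApprox-suc≤4* N s = *-cancelʳ-≤ _ _ (M ^ s) {{m^n≢0 M s}} (begin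
  (N + suc s) ^ N * M ^ s  ≡⟨ cong (λ x → x ^ N * M ^ s) (trans (+-suc N s) (+-comm 1 M)) ⟩
  (M + 1) ^ N * M ^ s      ≤⟨ *-monoʳ-≤ ((M + 1) ^ N) (^-monoˡ-≤ s (m≤m+n M 1)) ⟩
  (M + 1) ^ N * (M + 1) ^ s ≡⟨ ^-distribˡ-+-* (M + 1) N s ⟨
  (M + 1) ^ M              ≡⟨ *-identityʳ _ ⟨
  (M + 1) ^ M * 1 ^ 2      ≤⟨ lowerApprox≤upperApprox M 2 1 1 refl ⟩
  M ^ M * 2 ^ 2            ≡⟨ cong (_* 4) (^-distribˡ-+-* M N s) ⟩
  M ^ N * M ^ s * 4        ≡⟨ rotate (M ^ N) (M ^ s) 4 ⟩
  4 * M ^ N * M ^ s        ∎)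
  where
  open ≤-Reasoning
  M = N + s
  instance
    M≢0 : NonZero M
    M≢0 = >-nonZero (<-≤-trans (>-nonZero⁻¹ N) (m≤m+n N s))
  rotate : ∀ a b c → a * b * c ≡ c * a * b
  rotate = solve-∀

<lowerApprox⇒<4^ : ∀ {y} N t .{{_ : NonZero N}} .{{_ : NonZero t}} →
  y * N ^ N < (N + t) ^ N → y < 2 ^ (t + t)
<lowerApprox⇒<4^ {y} N t y<e^t = *-cancelʳ-< (N ^ N) y (2 ^ (t + t))
  (<-≤-trans y<e^t (≤-trans (lowerApprox≤4^ N t) (≤-reflexive (*-comm (N ^ N) _))))

<lowerApprox∧upperApprox<⇒<4* : ∀ {y n} N M s .{{_ : NonZero N}} → s < M →
  y * N ^ N < (N + suc s) ^ N → M ^ M < n * (M ∸ s) ^ M → y < 4 * n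
<lowerApprox∧upperApprox<⇒<4* {y} {n} N M s s<M y<e^[1+s] e^s<n =
  *-cancelʳ-< (N ^ N * q ^ M) y (4 * n) (begin-strict
    y * (N ^ N * q ^ M)       ≡⟨ *-assoc y (N ^ N) (q ^ M) ⟨
    y * N ^ N * q ^ M         <⟨ *-monoˡ-< (q ^ M) y<e^[1+s] ⟩
    (N + suc s) ^ N * q ^ M   ≤⟨ *-monoˡ-≤ (q ^ M) (lowerApprox-suc≤4* N s) ⟩
    4 * (N + s) ^ N * q ^ M   ≡⟨ *-assoc 4 ((N + s) ^ N) (q ^ M) ⟩
    4 * ((N + s) ^ N * q ^ M) ≤⟨ *-monoʳ-≤ 4 (lowerApprox≤upperApprox N M s q (m+[n∸m]≡n (<⇒≤ s<M))) ⟩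
    4 * (N ^ N * M ^ M)       ≤⟨ *-monoʳ-≤ 4 (*-monoʳ-≤ (N ^ N) (<⇒≤ e^s<n)) ⟩
    4 * (N ^ N * (n * q ^ M)) ≡⟨ swap 4 (N ^ N) n (q ^ M) ⟩
    4 * n * (N ^ N * q ^ M)   ∎)
  where
  open ≤-Reasoning
  q = M ∸ s
  instance
    M≢0 : NonZero M
    M≢0 = >-nonZero (≤-<-trans z≤n s<M)
    q^M≢0 : NonZero (q ^ M)
    q^M≢0 = m^n≢0 q M {{>-nonZero (m<n⇒0<n∸m s<M)}}
  swap : ∀ a b c d → a * (b * (c * d)) ≡ a * c * (b * d)
  swap = solve-∀

-- The pseudo-Smarandache function

2∣m*[1+m] : ∀ m → 2 ∣ m * suc m
2∣m*[1+m] zero    = divides 0 refl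
2∣m*[1+m] (suc m) = subst (2 ∣_) (shift m) (∣m∣n⇒∣m+n (2∣m*[1+m] m) (m∣m*n (suc m)))
  where
  shift : ∀ m → m * (1 + m) + 2 * (1 + m) ≡ (1 + m) * (2 + m)
  shift = solve-∀

∣T⇒∣m*[1+m] : ∀ {n} m → n ∣ T m → n ∣ m * suc m
∣T⇒∣m*[1+m] {n} m n∣T = subst (n ∣_) (m/n*n≡m (2∣m*[1+m] m)) (∣m⇒∣m*n 2 n∣T)

search-≥ : ∀ n m f → m ≤ search n m f
search-≥ n m zero = ≤-refl
search-≥ n m (suc f) with n ∣? T m
... | yes _ = ≤-refl
... | no  _ = ≤-trans (n≤1+n m) (search-≥ n (suc m) f)

search-∣ : ∀ n m f k → k ≤ f → n ∣ T (m + k) → n ∣ T (search n m f)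
search-∣ n m zero    zero    _   n∣T = subst (λ x → n ∣ T x) (+-identityʳ m) n∣T
search-∣ n m (suc f) k       k≤f n∣T with n ∣? T m
... | yes n∣T[m] = n∣T[m]
search-∣ n m (suc f) zero    _   n∣T | no n∤T[m] = contradiction (subst (λ x → n ∣ T x) (+-identityʳ m) n∣T) n∤T[m]
search-∣ n m (suc f) (suc k) k≤f n∣T | no _ =
  search-∣ n (suc m) f k (s≤s⁻¹ k≤f) (subst (λ x → n ∣ T x) (+-suc m k) n∣T)

1≤Z : ∀ n → 1 ≤ Z n
1≤Z n = search-≥ n 1 (2 * n)

n∣T[Z] : ∀ n .{{_ : NonZero n}} → n ∣ T (Z n)
n∣T[Z] n@(suc n-1) = search-∣ n 1 (2 * n) (2 * n-1) (*-monoʳ-≤ 2 (n≤1+n n-1))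
  (subst (n ∣_) (sym T[2n-1]) (n∣m*n (1 + 2 * n-1)))
  where
  double : ∀ k → (1 + 2 * k) * (1 + (1 + 2 * k)) ≡ (1 + 2 * k) * (1 + k) * 2
  double = solve-∀
  T[2n-1] : T (1 + 2 * n-1) ≡ (1 + 2 * n-1) * n
  T[2n-1] = trans (cong (_/ 2) (double n-1)) (m*n/n≡m _ 2)

record Split (n m : ℕ) : Set where
  constructor mkSplit
  field
    a b u v : ℕ
    n≡a*b   : n ≡ a * b
    m≡a*u   : m ≡ a * u
    1+m≡b*v : suc m ≡ b * v
    coprime : Coprime u v

  instance
    v≢0 : NonZero v
    v≢0 = m*n≢0⇒n≢0 b {{subst NonZero 1+m≡b*v _}}

  a/v : ℕ
  a/v = a / v

split : ∀ n m .{{_ : NonZero m}} → n ∣ m * suc m → Split n m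
split n m n∣m[1+m] = mkSplit a b u (quotient b∣1+m) n≡a*b m≡a*u (m∣n⇒n≡m*quotient b∣1+m) u⊥v
  where
  a = gcd n m
  instance
    a≢0 : NonZero a
    a≢0 = ≢-nonZero (gcd[m,n]≢0 n m (inj₂ (≢-nonZero⁻¹ m)))
  b = n / a
  u = m / a
  n≡a*b : n ≡ a * b
  n≡a*b = sym (m*[n/m]≡n (gcd[m,n]∣m n m))
  m≡a*u : m ≡ a * u
  m≡a*u = sym (m*[n/m]≡n (gcd[m,n]∣n n m))
  b∣1+m : b ∣ suc m
  b∣1+m = coprime-divisor (coprime-/gcd n m) (*-cancelˡ-∣ a (subst₂ _∣_ n≡a*b
    (trans (cong (_* suc m) m≡a*u) (*-assoc a u (suc m))) n∣m[1+m]))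
  u⊥v : Coprime u (quotient b∣1+m)
  u⊥v {d} (d∣u , d∣v) = ∣1⇒≡1 (∣m+n∣m⇒∣n
    (subst (d ∣_) (trans (sym (m∣n⇒n≡m*quotient b∣1+m)) (+-comm 1 m)) (∣n⇒∣m*n b d∣v))
    (subst (d ∣_) (sym m≡a*u) (∣n⇒∣m*n a d∣u)))

∣∸⇒%≡ : ∀ {a a'} v .{{_ : NonZero v}} → a ≤ a' → v ∣ a' ∸ a → a % v ≡ a' % v
∣∸⇒%≡ {a} {a'} v a≤a' (divides k a'∸a≡k*v) = begin
  a % v              ≡⟨ [m+kn]%n≡m%n a k v ⟨
  (a + k * v) % v    ≡⟨ cong (λ x → (a + x) % v) a'∸a≡k*v ⟨
  (a + (a' ∸ a)) % v ≡⟨ cong (_% v) (m+[n∸m]≡n a≤a') ⟩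
  a' % v             ∎
  where open ≡-Reasoning

%∧/⇒≡ : ∀ {a a'} v .{{_ : NonZero v}} → a % v ≡ a' % v → a / v ≡ a' / v → a ≡ a'
%∧/⇒≡ {a} {a'} v %≡ /≡ = begin
  a                   ≡⟨ m≡m%n+[m/n]*n a v ⟩
  a % v + a / v * v   ≡⟨ cong₂ (λ r q → r + q * v) %≡ /≡ ⟩
  a' % v + a' / v * v ≡⟨ m≡m%n+[m/n]*n a' v ⟨
  a'                  ∎
  where open ≡-Reasoning

inverse-%-unique-≤ : ∀ {u v a a'} .{{_ : NonZero v}} → Coprime u v → a ≤ a' →
  v ∣ suc (a * u) → v ∣ suc (a' * u) → a % v ≡ a' % v
inverse-%-unique-≤ {u} {v} {a} {a'} u⊥v a≤a' v∣1+au v∣1+a'u =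
  ∣∸⇒%≡ v a≤a' (coprime-divisor (Coprime.sym u⊥v) v∣u*[a'∸a])
  where
  expand : suc (a * u) + u * (a' ∸ a) ≡ suc (a' * u)
  expand = cong suc (begin
    a * u + u * (a' ∸ a)   ≡⟨ cong (a * u +_) (*-comm u (a' ∸ a)) ⟩
    a * u + (a' ∸ a) * u   ≡⟨ *-distribʳ-+ u a (a' ∸ a) ⟨
    (a + (a' ∸ a)) * u     ≡⟨ cong (_* u) (m+[n∸m]≡n a≤a') ⟩
    a' * u                 ∎)
    where open ≡-Reasoning
  v∣u*[a'∸a] : v ∣ u * (a' ∸ a)
  v∣u*[a'∸a] = ∣m+n∣m⇒∣n (subst (v ∣_) (sym expand) v∣1+a'u) v∣1+au

inverse-%-unique : ∀ {u v a a'} .{{_ : NonZero v}} → Coprime u v →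
  v ∣ suc (a * u) → v ∣ suc (a' * u) → a % v ≡ a' % v
inverse-%-unique {a = a} {a'} u⊥v v∣1+au v∣1+a'u with ≤-total a a'
... | inj₁ a≤a' = inverse-%-unique-≤ u⊥v a≤a' v∣1+au v∣1+a'u
... | inj₂ a'≤a = sym (inverse-%-unique-≤ u⊥v a'≤a v∣1+a'u v∣1+au)

split-injective : ∀ {n n' m m'} (σ : Split n m) (σ' : Split n' m') →
  Split.u σ ≡ Split.u σ' → Split.v σ ≡ Split.v σ' → Split.a/v σ ≡ Split.a/v σ' → n ≡ n'
split-injective {n} {n'} {m} {m'} σ@(mkSplit a b u v n≡a*b m≡a*u 1+m≡b*v u⊥v)
                (mkSplit a' b' _ _ n'≡a'*b' m'≡a'*u 1+m'≡b'*v _) refl refl a/v≡a'/v = begin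
  n       ≡⟨ n≡a*b ⟩
  a * b   ≡⟨ cong₂ _*_ a≡a' b≡b' ⟩
  a' * b' ≡⟨ n'≡a'*b' ⟨
  n'      ∎
  where
  open ≡-Reasoning
  open Split σ using (v≢0)
  a≡a' : a ≡ a'
  a≡a' = %∧/⇒≡ v (inverse-%-unique u⊥v (divides b (trans (cong suc (sym m≡a*u)) 1+m≡b*v))
                                        (divides b' (trans (cong suc (sym m'≡a'*u)) 1+m'≡b'*v)))
                 a/v≡a'/v
  b≡b' : b ≡ b'
  b≡b' = *-cancelʳ-≡ b b' v (begin
    b * v    ≡⟨ 1+m≡b*v ⟨
    suc m    ≡⟨ cong suc (trans m≡a*u (trans (cong (_* u) a≡a') (sym m'≡a'*u))) ⟩
    suc m'   ≡⟨ 1+m'≡b'*v ⟩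
    b' * v   ∎)

-- Encoding n by (u, v, ⌊a/v⌋)

radix-< : ∀ {A B x z} → x < A → z < B → x * B + z < A * B
radix-< {A} {B} {x} {z} x<A z<B = begin-strict
  x * B + z  <⟨ +-monoʳ-< (x * B) z<B ⟩
  x * B + B  ≡⟨ +-comm (x * B) B ⟩
  suc x * B  ≤⟨ *-monoˡ-≤ B x<A ⟩
  A * B      ∎
  where open ≤-Reasoning

radix-injective : ∀ {B x z x' z'} → z < B → z' < B → x * B + z ≡ x' * B + z' → x ≡ x' × z ≡ z'
radix-injective {B} {x} {z} {x'} {z'} z<B z'<B eq = x≡x' , z≡z'
  where
  instance
    B≢0 : NonZero B
    B≢0 = >-nonZero (≤-<-trans z≤n z<B)
  z≡z' : z ≡ z'
  z≡z' = begin
    z                ≡⟨ m<n⇒m%n≡m z<B ⟨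
    z % B            ≡⟨ [m+kn]%n≡m%n z x B ⟨
    (z + x * B) % B  ≡⟨ cong (_% B) (trans (+-comm z (x * B)) (trans eq (+-comm (x' * B) z'))) ⟩
    (z' + x' * B) % B ≡⟨ [m+kn]%n≡m%n z' x' B ⟩
    z' % B           ≡⟨ m<n⇒m%n≡m z'<B ⟩
    z'               ∎
    where open ≡-Reasoning
  x≡x' : x ≡ x'
  x≡x' = *-cancelʳ-≡ x x' B (+-cancelʳ-≡ z (x * B) (x' * B) (subst (λ w → x * B + z ≡ x' * B + w) (sym z≡z') eq))

record DyadicRange (i u : ℕ) : Set where
  constructor dyadic
  field
    lower : 2 ^ i ≤ u
    upper : u < 2 ^ suc i

dyadicRange : ∀ k u .{{_ : NonZero u}} → u < 2 ^ k → ∃[ i ] i < k × DyadicRange i u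
dyadicRange zero    u u<1 = contradiction (>-nonZero⁻¹ u) (<⇒≱ u<1)
dyadicRange (suc k) u u<2^[1+k] with 2 ^ k ≤? u
... | yes 2^k≤u = k , n<1+n k , dyadic 2^k≤u u<2^[1+k]
... | no  2^k≰u with i , i<k , u∈ ← dyadicRange k u (≰⇒> 2^k≰u) = i , m<n⇒m<1+n i<k , u∈

dyadicRange-offset< : ∀ {i u} → DyadicRange i u → u ∸ 2 ^ i < 2 ^ i
dyadicRange-offset< {i} {u} (dyadic 2^i≤u u<2^[1+i]) = +-cancelˡ-< (2 ^ i) _ _ (begin-strict
  2 ^ i + (u ∸ 2 ^ i)  ≡⟨ m+[n∸m]≡n 2^i≤u ⟩
  u                    <⟨ u<2^[1+i] ⟩
  2 * 2 ^ i            ≡⟨ cong (2 ^ i +_) (+-identityʳ (2 ^ i)) ⟩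
  2 ^ i + 2 ^ i        ∎)
  where open ≤-Reasoning

boxIndex : ℕ → ℕ → ℕ → ℕ → ℕ
boxIndex i j u v = (u ∸ 2 ^ i) * 2 ^ j + (v ∸ 2 ^ j)

boxIndex-< : ∀ {i j u v} → DyadicRange i u → DyadicRange j v → boxIndex i j u v < 2 ^ i * 2 ^ j
boxIndex-< u∈ v∈ = radix-< (dyadicRange-offset< u∈) (dyadicRange-offset< v∈)

boxIndex-injective : ∀ {i j u v u' v'} → DyadicRange i u → DyadicRange j v →
  DyadicRange i u' → DyadicRange j v' → boxIndex i j u v ≡ boxIndex i j u' v' → u ≡ u' × v ≡ v'
boxIndex-injective {i} {j} u∈ v∈ u'∈ v'∈ eq
  with u-offset≡ , v-offset≡ ← radix-injective (dyadicRange-offset< v∈) (dyadicRange-offset< v'∈) eq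
  = offset-injective u∈ u'∈ u-offset≡ , offset-injective v∈ v'∈ v-offset≡
  where
  offset-injective : ∀ {k w w'} → DyadicRange k w → DyadicRange k w' → w ∸ 2 ^ k ≡ w' ∸ 2 ^ k → w ≡ w'
  offset-injective {k} (dyadic 2^k≤w _) (dyadic 2^k≤w' _) eq =
    trans (sym (m∸n+n≡m 2^k≤w)) (trans (cong (_+ 2 ^ k) eq) (m∸n+n≡m 2^k≤w'))

box≢0 : ∀ i j → NonZero (2 ^ i * 2 ^ j)
box≢0 i j = m*n≢0 (2 ^ i) (2 ^ j) {{m^n≢0 2 i}} {{m^n≢0 2 j}}

height : ℕ → ℕ → ℕ → ℕ
height y i j = suc ((y / (2 ^ i * 2 ^ j)) {{box≢0 i j}})

<height : ∀ {y i j u v q} → DyadicRange i u → DyadicRange j v → q * (u * v) ≤ y → q < height y i j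
<height {y} {i} {j} {u} {v} {q} u∈ v∈ q*uv≤y = s≤s (begin
  q         ≡⟨ m*n/n≡m q D ⟨
  q * D / D ≤⟨ /-monoˡ-≤ D (≤-trans (*-monoʳ-≤ q (*-mono-≤ (lower u∈) (lower v∈))) q*uv≤y) ⟩
  y / D     ∎)
  where
  open ≤-Reasoning
  open DyadicRange
  D = 2 ^ i * 2 ^ j
  instance
    D≢0 : NonZero D
    D≢0 = box≢0 i j

cellIndex : ℕ → ℕ → ℕ → ℕ → ℕ → ℕ → ℕ
cellIndex y i j u v q = boxIndex i j u v * height y i j + q

cellIndex-< : ∀ {y i j u v q} → DyadicRange i u → DyadicRange j v →
  q * (u * v) ≤ y → u * v < 4 * suc y → cellIndex y i j u v q < 5 * y + 4
cellIndex-< {y} {i} {j} {u} {v} u∈ v∈ q*uv≤y uv<4[1+y] = begin-strict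
  cellIndex y i j u v _    <⟨ radix-< (boxIndex-< u∈ v∈) (<height u∈ v∈ q*uv≤y) ⟩
  D * suc (y / D)          ≡⟨ *-suc D (y / D) ⟩
  D + D * (y / D)          ≤⟨ +-monoʳ-≤ D (≤-trans (≤-reflexive (*-comm D (y / D))) (m/n*n≤m y D)) ⟩
  D + y                    ≤⟨ +-monoˡ-≤ y (*-mono-≤ (DyadicRange.lower u∈) (DyadicRange.lower v∈)) ⟩
  u * v + y                <⟨ +-monoˡ-< y uv<4[1+y] ⟩
  4 * suc y + y            ≡⟨ collect y ⟩
  5 * y + 4                ∎
  where
  open ≤-Reasoning
  D = 2 ^ i * 2 ^ j
  instance
    D≢0 : NonZero D
    D≢0 = box≢0 i j
  collect : ∀ y → 4 * (1 + y) + y ≡ 5 * y + 4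
  collect = solve-∀

cellIndex-injective : ∀ {y i j u v q i' j' u' v' q'} → i ≡ i' → j ≡ j' →
  DyadicRange i u → DyadicRange j v → DyadicRange i' u' → DyadicRange j' v' →
  q < height y i j → q' < height y i' j' →
  cellIndex y i j u v q ≡ cellIndex y i' j' u' v' q' → u ≡ u' × v ≡ v' × q ≡ q'
cellIndex-injective refl refl u∈ v∈ u'∈ v'∈ q<H q'<H eq
  with box≡ , q≡q' ← radix-injective q<H q'<H eq
  with u≡u' , v≡v' ← boxIndex-injective u∈ v∈ u'∈ v'∈ box≡
  = u≡u' , v≡v' , q≡q'

-- The code lists, as mixed-radix digits, the box (i, j) of (u, v), the position of (u, v)
-- in that box and ⌊a/v⌋.
record Encoding (y J n : ℕ) : Set where
  field
    splitting : Split n (Z n)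
  open Split splitting public
  field
    i j       : ℕ
    i<J       : i < J
    j<J       : j < J
    u∈        : DyadicRange i u
    v∈        : DyadicRange j v
    a/v*uv≤y  : a/v * (u * v) ≤ y
    uv<4[1+y] : u * v < 4 * suc y

  a/v<height : a/v < height y i j
  a/v<height = <height u∈ v∈ a/v*uv≤y

  cell : ℕ
  cell = cellIndex y i j u v a/v

  cell<5y+4 : cell < 5 * y + 4
  cell<5y+4 = cellIndex-< u∈ v∈ a/v*uv≤y uv<4[1+y]

  code : ℕ
  code = (i * J + j) * (5 * y + 4) + cell

  code< : code < J * J * (5 * y + 4)
  code< = radix-< (radix-< i<J j<J) cell<5y+4

encoding : ∀ {y J n} → 4 * suc y ≤ 2 ^ J → Z n ≤ y → y < 4 * n → Encoding y J n
encoding {y} {J} {n} 4[1+y]≤2^J Zn≤y y<4n =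
  let i , i<J , u∈ = dyadicRange J u (≤-<-trans (m≤m*n u v) uv<2^J)
      j , j<J , v∈ = dyadicRange J v (≤-<-trans (m≤n*m v u) uv<2^J)
  in record { splitting = σ ; i = i ; j = j ; i<J = i<J ; j<J = j<J ; u∈ = u∈ ; v∈ = v∈
            ; a/v*uv≤y = a/v*uv≤y ; uv<4[1+y] = uv<4[1+y] }
  where
  m = Z n
  instance
    n≢0 : NonZero n
    n≢0 = m*n≢0⇒n≢0 4 {{>-nonZero (≤-<-trans z≤n y<4n)}}
    m≢0 : NonZero m
    m≢0 = >-nonZero (1≤Z n)
  σ = split n m (∣T⇒∣m*[1+m] m (n∣T[Z] n))
  open Split σ
  instance
    u≢0 : NonZero u
    u≢0 = m*n≢0⇒n≢0 a {{subst NonZero m≡a*u m≢0}}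
  uv*n≡m*[1+m] : u * v * n ≡ m * suc m
  uv*n≡m*[1+m] = begin
    u * v * n       ≡⟨ cong (u * v *_) n≡a*b ⟩
    u * v * (a * b) ≡⟨ regroup u v a b ⟩
    a * u * (b * v) ≡⟨ cong₂ _*_ m≡a*u 1+m≡b*v ⟨
    m * suc m       ∎
    where
    open ≡-Reasoning
    regroup : ∀ u v a b → u * v * (a * b) ≡ a * u * (b * v)
    regroup = solve-∀
  uv<4[1+y] : u * v < 4 * suc y
  uv<4[1+y] = *-cancelʳ-< n (u * v) (4 * suc y) (begin-strict
    u * v * n       ≡⟨ uv*n≡m*[1+m] ⟩
    m * suc m       ≤⟨ *-mono-≤ Zn≤y (s≤s Zn≤y) ⟩
    y * suc y       <⟨ *-monoˡ-< (suc y) y<4n ⟩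
    4 * n * suc y   ≡⟨ xy∙z≈xz∙y 4 n (suc y) ⟩
    4 * suc y * n   ∎)
    where open ≤-Reasoning
  uv<2^J : u * v < 2 ^ J
  uv<2^J = <-≤-trans uv<4[1+y] 4[1+y]≤2^J
  a/v*uv≤y : a/v * (u * v) ≤ y
  a/v*uv≤y = begin
    a/v * (u * v)   ≡⟨ *-assoc a/v u v ⟨
    a/v * u * v     ≡⟨ xy∙z≈xz∙y a/v u v ⟩
    a/v * v * u     ≤⟨ *-monoˡ-≤ u (m/n*n≤m a v) ⟩
    a * u           ≡⟨ m≡a*u ⟨
    m               ≤⟨ Zn≤y ⟩
    y               ∎
    where open ≤-Reasoning

code-injective : ∀ {y J n n'} (e : Encoding y J n) (e' : Encoding y J n') →
  Encoding.code e ≡ Encoding.code e' → n ≡ n'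
code-injective e e' eq =
  let ij≡ , cell≡    = radix-injective (cell<5y+4 e) (cell<5y+4 e') eq
      i≡ , j≡        = radix-injective (j<J e) (j<J e') ij≡
      u≡ , v≡ , a/v≡ = cellIndex-injective i≡ j≡ (u∈ e) (v∈ e) (u∈ e') (v∈ e')
                                           (a/v<height e) (a/v<height e') cell≡
  in split-injective (splitting e) (splitting e') u≡ v≡ a/v≡
  where open Encoding

-- Counting

unique⇒lookup-injective : ∀ {A : Set} {xs : List A} → Unique xs → ∀ i j → lookup xs i ≡ lookup xs j → i ≡ j
unique⇒lookup-injective (x∉xs ∷ _)  zero    zero    _  = refl
unique⇒lookup-injective (x∉xs ∷ _)  zero    (suc j) eq = contradiction eq (All.lookup x∉xs (∈-lookup j))
unique⇒lookup-injective (x∉xs ∷ _)  (suc i) zero    eq = contradiction (sym eq) (All.lookup x∉xs (∈-lookup i))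
unique⇒lookup-injective (_ ∷ xs!)   (suc i) (suc j) eq = cong suc (unique⇒lookup-injective xs! i j eq)

length≤-by-code : ∀ {A : Set} {P : A → Set} {B : ℕ} (code : ∀ {x} → P x → ℕ) →
  (∀ {x} (p : P x) → code p < B) →
  (∀ {x x'} (p : P x) (p' : P x') → code p ≡ code p' → x ≡ x') →
  ∀ {xs} → Unique xs → All P xs → length xs ≤ B
length≤-by-code {P = P} {B} code code<B code-injective {xs} xs! ps = injective⇒≤ {f = code∘lookup} injective
  where
  p : ∀ i → P (lookup xs i)
  p i = All.lookup ps (∈-lookup i)
  code∘lookup : Fin (length xs) → Fin B
  code∘lookup i = fromℕ< (code<B (p i))
  injective : ∀ {i j} → code∘lookup i ≡ code∘lookup j → i ≡ j
  injective {i} {j} eq = unique⇒lookup-injective xs! i j (code-injective (p i) (p j)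
    (trans (sym (toℕ-fromℕ< (code<B (p i)))) (trans (cong toℕ eq) (toℕ-fromℕ< (code<B (p j))))))

length≤J²[5y+4] : ∀ y J {ns} → 4 * suc y ≤ 2 ^ J → Unique ns →
  All (λ n → Z n ≤ y × y < 4 * n) ns → length ns ≤ J * J * (5 * y + 4)
length≤J²[5y+4] y J 4[1+y]≤2^J ns! bounds = length≤-by-code Encoding.code Encoding.code< code-injective ns!
  (All.map (λ (Zn≤y , y<4n) → encoding {J = J} 4[1+y]≤2^J Zn≤y y<4n) bounds)

[2+2t]²[5y+4]≤196yt² : ∀ y t → 1 ≤ y → 1 ≤ t → (2 + (t + t)) * (2 + (t + t)) * (5 * y + 4) ≤ 196 * y * t ^ 2
[2+2t]²[5y+4]≤196yt² y t 1≤y 1≤t = begin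
  (2 + (t + t)) * (2 + (t + t)) * (5 * y + 4) ≤⟨ *-mono-≤ (*-mono-≤ 2+2t≤4t 2+2t≤4t) 5y+4≤9y ⟩
  (4 * t) * (4 * t) * (9 * y)                 ≡⟨ collect y t ⟩
  144 * y * t ^ 2                             ≤⟨ *-monoˡ-≤ (t ^ 2) (*-monoˡ-≤ y (m≤m+n 144 52)) ⟩
  196 * y * t ^ 2                             ∎
  where
  open ≤-Reasoning
  2+2t≤4t : 2 + (t + t) ≤ 4 * t
  2+2t≤4t = ≤-trans (+-monoˡ-≤ (t + t) (+-mono-≤ 1≤t 1≤t)) (≤-reflexive (double t))
    where
    double : ∀ t → t + t + (t + t) ≡ 4 * t
    double = solve-∀
  5y+4≤9y : 5 * y + 4 ≤ 9 * y
  5y+4≤9y = ≤-trans (+-monoʳ-≤ (5 * y) (*-monoʳ-≤ 4 1≤y)) (≤-reflexive (nine y))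
    where
    nine : ∀ y → 5 * y + 4 * y ≡ 9 * y
    nine = solve-∀
  collect : ∀ y t → 4 * t * (4 * t) * (9 * y) ≡ 144 * y * (t * (t * 1))
  collect = solve-∀

length≤196yt² : ∀ y t {ns} → 1 ≤ y → 1 ≤ t → y < 2 ^ (t + t) → Unique ns →
  All (λ n → Z n ≤ y × y < 4 * n) ns → length ns ≤ 196 * y * t ^ 2
length≤196yt² y t 1≤y 1≤t y<4^t ns! bounds =
  ≤-trans (length≤J²[5y+4] y (2 + (t + t)) 4[1+y]≤2^J ns! bounds) ([2+2t]²[5y+4]≤196yt² y t 1≤y 1≤t)
  where
  4[1+y]≤2^J : 4 * suc y ≤ 2 * (2 * 2 ^ (t + t))
  4[1+y]≤2^J = ≤-trans (*-monoʳ-≤ 4 y<4^t) (≤-reflexive (*-assoc 2 2 (2 ^ (t + t))))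

ℕ→ℚ≡mkℚ : ∀ n → ℕ→ℚ n ≡ mkℚ (ℤ.+ n) 0 (Coprime.sym (1-coprimeTo n))
ℕ→ℚ≡mkℚ n = ℚ.↥p/↧p≡p (mkℚ (ℤ.+ n) 0 (Coprime.sym (1-coprimeTo n)))

ℕ→ℚ-mono-≤ : ∀ {m n} → m ≤ n → ℕ→ℚ m ≤ℚ ℕ→ℚ n
ℕ→ℚ-mono-≤ {m} {n} m≤n rewrite ℕ→ℚ≡mkℚ m | ℕ→ℚ≡mkℚ n =
  ℚ.*≤* (subst₂ ℤ._≤_ (sym (ℤ.*-identityʳ (ℤ.+ m))) (sym (ℤ.*-identityʳ (ℤ.+ n))) (ℤ.+≤+ m≤n))

ℕ→ℚ-cancel-< : ∀ {m n} → ℕ→ℚ m <ℚ ℕ→ℚ n → m < n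
ℕ→ℚ-cancel-< {m} {n} m<n rewrite ℕ→ℚ≡mkℚ m | ℕ→ℚ≡mkℚ n with ℚ.*<* m*1<n*1 ← m<n =
  ℤ.drop‿+<+ (subst₂ ℤ._<_ (ℤ.*-identityʳ (ℤ.+ m)) (ℤ.*-identityʳ (ℤ.+ n)) m*1<n*1)

ℕ→ℚ-homo-* : ∀ m n → ℕ→ℚ (m * n) ≡ ℕ→ℚ m *ℚ ℕ→ℚ n
ℕ→ℚ-homo-* m n rewrite ℕ→ℚ≡mkℚ m | ℕ→ℚ≡mkℚ n | sym (ℤ.pos-* m n) = refl

ℕ→ℚ-nonNeg : ∀ n → ℚ.NonNegative (ℕ→ℚ n)
ℕ→ℚ-nonNeg n = ℚ.normalize-nonNeg n 1

ℕ→ℚ[c*y*k]≤c*Y*k : ∀ c y k {Y} → ℕ→ℚ y ≤ℚ Y → ℕ→ℚ (c * y * k) ≤ℚ (ℕ→ℚ c *ℚ Y) *ℚ ℕ→ℚ k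
ℕ→ℚ[c*y*k]≤c*Y*k c y k y≤Y = subst (_≤ℚ _) (sym (trans (ℕ→ℚ-homo-* (c * y) k) (cong (_*ℚ ℕ→ℚ k) (ℕ→ℚ-homo-* c y))))
  (ℚ.*-monoʳ-≤-nonNeg (ℕ→ℚ k) {{ℕ→ℚ-nonNeg k}} (ℚ.*-monoˡ-≤-nonNeg (ℕ→ℚ c) {{ℕ→ℚ-nonNeg c}} y≤Y))

ℕ→ℚ-≤∧*<⇒*< : ∀ {y Y A B} → ℕ→ℚ y ≤ℚ Y → Y *ℚ ℕ→ℚ A <ℚ ℕ→ℚ B → y * A < B
ℕ→ℚ-≤∧*<⇒*< {y} {Y} {A} y≤Y YA<B = ℕ→ℚ-cancel-< (ℚ.≤-<-trans
  (subst (_≤ℚ Y *ℚ ℕ→ℚ A) (sym (ℕ→ℚ-homo-* y A)) (ℚ.*-monoʳ-≤-nonNeg (ℕ→ℚ A) {{ℕ→ℚ-nonNeg A}} y≤Y)) YA<B)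

ℕ→ℚ-cancel-<-* : ∀ {A n B} → ℕ→ℚ A <ℚ ℕ→ℚ n *ℚ ℕ→ℚ B → A < n * B
ℕ→ℚ-cancel-<-* {A} {n} {B} A<nB = ℕ→ℚ-cancel-< (subst (ℕ→ℚ A <ℚ_) (sym (ℕ→ℚ-homo-* n B)) A<nB)

lemma5 : (t : ℕ) → 5 ≤ t → (Y : ℚ) →
    0ℚ <ℚ Y → ExpLt (t ∸ 1) (Y *ℚ Y) → LtExp t Y →
    (ns : List ℕ) → Unique ns →
    All (λ n → ExpLt (t ∸ 1) (ℕ→ℚ n) × ¬ ExpLt t (ℕ→ℚ n) × ℕ→ℚ (Z n) ≤ℚ Y) ns →
    ℕ→ℚ (length ns) ≤ℚ ((ℕ→ℚ 196 *ℚ Y) *ℚ ℕ→ℚ (t ^ 2))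
lemma5 t _ _ 0<Y _ _ [] _ _ = ℕ→ℚ[c*y*k]≤c*Y*k 196 0 (t ^ 2) (ℚ.<⇒≤ 0<Y)
lemma5 zero () _ _ _ _ _ _ _
lemma5 (suc s) _ Y _ _ (N , N≢0 , Y<e^t) ns@(n₀ ∷ ns') ns! hyps = ℚ.≤-trans
  (ℕ→ℚ-mono-≤ (length≤196yt² y t 1≤y (s≤s z≤n) (<lowerApprox⇒<4^ N t y<e^t) ns! (All.zip (Z≤y , y<4n))))
  (ℕ→ℚ[c*y*k]≤c*Y*k 196 y (t ^ 2) y≤Y)
  where
  t = suc s
  instance _ = N≢0
  y = Z (argmax Z n₀ ns')
  y≤Y : ℕ→ℚ y ≤ℚ Y
  y≤Y = proj₂ (proj₂ (argmax-all Z (All.head hyps) (All.tail hyps)))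
  y<e^t : y * N ^ N < (N + t) ^ N
  y<e^t = ℕ→ℚ-≤∧*<⇒*< {y} {A = N ^ N} y≤Y Y<e^t
  Z≤y : All (λ n → Z n ≤ y) ns
  Z≤y = f[⊥]≤f[argmax] {f = Z} n₀ ns' ∷ f[xs]≤f[argmax] {f = Z} n₀ ns'
  1≤y : 1 ≤ y
  1≤y = ≤-trans (1≤Z n₀) (All.head Z≤y)
  y<4n : All (λ n → y < 4 * n) ns
  y<4n = All.map (λ {n} ((M , s<M , e^s<n) , _) → <lowerApprox∧upperApprox<⇒<4* {y} {n} N M s s<M y<e^t
                   (ℕ→ℚ-cancel-<-* {M ^ M} {n} {(M ∸ s) ^ M} e^s<n)) hyps
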